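{- Let $p$ be a prime and $i$ a positive integer. Let $J$ be an ideal of $[0,i-1]^2$, $K$ an ideal of $[0,i]^2$, and $b\ge0$ an integer. Then $\bigl[J+D+(0,-b)\bigr]\cap[0,i]^2\subseteq K$ if and only if $\bigl[J+D+(0,-b)\bigr]\cap[0,i-1]^2\subseteq K\cap[0,i-1]^2$.
   Context: $D=\{(x,y)\in\mathbb{R}^2: x+py\le 0,\ p^2x+y\le 0\}$; $u\prec v$ means $u\in v+D$. An ideal of $\Omega\subseteq\mathbb{R}^2$ is $I\subseteq\Omega$ with $u\in I$, $v\in\Omega$, $v\prec u\Rightarrow v\in I$. $[a,b]=\{x\in\mathbb{Z}:a\le x\le b\}$; sums are Minkowski sums in $\mathbb{R}^2$. -}

module Defs where

open import Level using (0ℓ)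
open import Data.Nat using (ℕ)
open import Data.Integer using (ℤ; +_; -_; _+_; _-_; _*_; _≤_)
open import Data.Product using (_×_; _,_; Σ; ∃)
open import Relation.Unary using (Pred; _∈_; _⊆_; _∩_)
open import Relation.Binary.PropositionalEquality using (_≡_)

-- Points of the integer lattice ℤ² (all sets in the statement are subsets of ℤ²
-- or are only intersected with subsets of ℤ²).
Pt : Set
Pt = ℤ × ℤ

_⊕_ : Pt → Pt → Pt
(a , b) ⊕ (c , d) = (a + c , b + d)

_⊖_ : Pt → Pt → Pt
(a , b) ⊖ (c , d) = (a - c , b - d)

D : ℕ → Pred Pt 0ℓ
D p (x , y) = (x + (+ p) * y ≤ + 0) × ((+ p) * (+ p) * x + y ≤ + 0)

_≺[_]_ : Pt → ℕ → Pt → Set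
u ≺[ p ] v = (u ⊖ v) ∈ D p

Box : ℤ → ℤ → Pred Pt 0ℓ
Box lo hi (x , y) = (lo ≤ x × x ≤ hi) × (lo ≤ y × y ≤ hi)

IsIdeal : ℕ → Pred Pt 0ℓ → Pred Pt 0ℓ → Set
IsIdeal p Ω I = (I ⊆ Ω) × (∀ {u v} → u ∈ I → v ∈ Ω → v ≺[ p ] u → v ∈ I)

JDb : ℕ → Pred Pt 0ℓ → ℕ → Pred Pt 0ℓ
JDb p J b w = Σ Pt λ u → Σ Pt λ d → u ∈ J × d ∈ D p × w ≡ (u ⊕ d) ⊕ (+ 0 , - (+ b))

module Submission where

-- Only the points of [0,i]² on its right edge (x = i) or top edge (y = i) are new. If
-- w = u + d + (0,-b) with u ∈ J ⊆ [0,i-1]² lies on the right edge, then d₁ ≥ 1, and moving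
-- d by (-1, p²) keeps it in D; the resulting point w′ of J + D + (0,-b) lies in [0,i-1]²
-- and dominates w, so w ∈ K because K is an ideal. The top edge is handled the same way
-- with the step (p, -1).

open import Defs
open import Data.Nat using (ℕ; _≤_)
open import Data.Nat.Primality using (Prime; prime⇒nonZero)
open import Data.Integer as ℤ using (ℤ; 0ℤ; 1ℤ; +_; _+_; _-_; _*_; -_; pred; +≤+)
open import Relation.Unary using (Pred; _⊆_; _∩_; _∈_)
open import Data.Product using (_×_; _,_; proj₁; proj₂; ∃)
open import Function.Bundles using (_⇔_; mk⇔)
open import Level using (0ℓ)

import Data.Nat as ℕ
open import Data.Integer.Properties
  using (≤-refl; ≤-trans; ≤-reflexive; ≰⇒>; i<j⇒suc[i]≤j; suc-pred; i≤j⇒i-j≤0; i-j≤0⇒i≤j;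
         i≤j⇒0≤j-i; i≤j⇒i-k≤j; +-mono-≤; +-monoˡ-≤; +-identityʳ; *-monoˡ-≤-nonNeg; *-zeroʳ;
         neg-≤-pos; nonNegative⁻¹; pos-*)
open import Data.Integer.Tactic.RingSolver using (solve-∀)
open import Data.Sum using (_⊎_; inj₁; inj₂)
open import Relation.Binary.PropositionalEquality using (_≡_; refl; sym; cong; cong₂; subst)
open import Relation.Nullary using (yes; no)

-- Linear inequalities are certified Farkas-style: the ring solver rewrites the quantity
-- as a nonnegative combination of quantities already known to be ≤ 0.
≤0-by : ∀ {e f} → e ≡ f → f ℤ.≤ 0ℤ → e ℤ.≤ 0ℤ
≤0-by refl f≤0 = f≤0

nonneg*nonpos≤0 : ∀ {k f} → 0ℤ ℤ.≤ k → f ℤ.≤ 0ℤ → k * f ℤ.≤ 0ℤ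
nonneg*nonpos≤0 {+ n} {f} (+≤+ _) f≤0 =
  subst (+ n * f ℤ.≤_) (*-zeroʳ (+ n)) (*-monoˡ-≤-nonNeg (+ n) f≤0)

+-nonpos-≤ : ∀ {i j m} → i ℤ.≤ m → j ℤ.≤ 0ℤ → i + j ℤ.≤ m
+-nonpos-≤ {m = m} i≤m j≤0 = subst (_ ℤ.≤_) (+-identityʳ m) (+-mono-≤ i≤m j≤0)

+-nonneg-≥ : ∀ {m i j} → m ℤ.≤ i → 0ℤ ℤ.≤ j → m ℤ.≤ i + j
+-nonneg-≥ {m} m≤i 0≤j = subst (ℤ._≤ _) (+-identityʳ m) (+-mono-≤ m≤i 0≤j)

-- pred (+ n) and + n - + 1 are definitionally equal.
≤pred⊎≥ : ∀ x n → x ℤ.≤ + n - + 1 ⊎ + n ℤ.≤ x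
≤pred⊎≥ x n with x ℤ.≤? pred (+ n)
... | yes x≤pred = inj₁ x≤pred
... | no x≰pred = inj₂ (subst (ℤ._≤ x) (suc-pred (+ n)) (i<j⇒suc[i]≤j (≰⇒> x≰pred)))

cube-pred-nonneg : ∀ p .{{_ : ℕ.NonZero p}} → 0ℤ ℤ.≤ + p * + p * + p - 1ℤ
cube-pred-nonneg (ℕ.suc _) = +≤+ ℕ.z≤n

⊕-shift : ∀ u d v e → ((u ⊕ d) ⊕ v) ⊕ e ≡ (u ⊕ (d ⊕ e)) ⊕ v
⊕-shift (a , c) (d₁ , d₂) (v₁ , v₂) (e₁ , e₂) = cong₂ _,_ (shift a d₁ v₁ e₁) (shift c d₂ v₂ e₂)
  where
  shift : ∀ a d v e → ((a + d) + v) + e ≡ (a + (d + e)) + v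
  shift = solve-∀

Box-widen : ∀ {lo hi hi′} → hi ℤ.≤ hi′ → Box lo hi ⊆ Box lo hi′
Box-widen hi≤hi′ ((lo≤x , x≤hi) , (lo≤y , y≤hi)) =
  (lo≤x , ≤-trans x≤hi hi≤hi′) , (lo≤y , ≤-trans y≤hi hi≤hi′)

-- The negated steps (1, -p²) and (-p, 1) span the two boundary rays of the cone D.
stepˣ stepʸ : ℕ → Pt
stepˣ p = (- 1ℤ , + p * + p)
stepʸ p = (+ p , - 1ℤ)

D-fst-nonneg⇒snd-nonpos : ∀ p {d₁ d₂} → (d₁ , d₂) ∈ D p → 0ℤ ℤ.≤ d₁ → d₂ ℤ.≤ 0ℤ
D-fst-nonneg⇒snd-nonpos p {d₁} {d₂} (_ , second) 0≤d₁ =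
  ≤0-by (identity (+ p) d₁ d₂)
        (+-mono-≤ second (nonneg*nonpos≤0 0≤p (nonneg*nonpos≤0 0≤p (i≤j⇒i-j≤0 0≤d₁))))
  where
  0≤p : 0ℤ ℤ.≤ + p
  0≤p = nonNegative⁻¹ (+ p)
  identity : ∀ P d₁ d₂ → d₂ ≡ (P * P * d₁ + d₂) + P * (P * (0ℤ - d₁))
  identity = solve-∀

D-snd-nonneg⇒fst-nonpos : ∀ p {d₁ d₂} → (d₁ , d₂) ∈ D p → 0ℤ ℤ.≤ d₂ → d₁ ℤ.≤ 0ℤ
D-snd-nonneg⇒fst-nonpos p {d₁} {d₂} (first , _) 0≤d₂ =
  ≤0-by (identity (+ p) d₁ d₂) (+-mono-≤ first (nonneg*nonpos≤0 (nonNegative⁻¹ (+ p)) (i≤j⇒i-j≤0 0≤d₂)))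
  where
  identity : ∀ P d₁ d₂ → d₁ ≡ (d₁ + P * d₂) + P * (0ℤ - d₂)
  identity = solve-∀

D-stepˣ : ∀ p .{{_ : ℕ.NonZero p}} {d₁ d₂} → (d₁ , d₂) ∈ D p → 1ℤ ℤ.≤ d₁ → (d₁ , d₂) ⊕ stepˣ p ∈ D p
D-stepˣ p {d₁} {d₂} (_ , second) 1≤d₁ =
    ≤0-by (identity₁ (+ p) d₁ d₂)
          (+-mono-≤ (nonneg*nonpos≤0 (nonNegative⁻¹ (+ p)) second)
                    (nonneg*nonpos≤0 (cube-pred-nonneg p) (i≤j⇒i-j≤0 1≤d₁)))
  , ≤0-by (identity₂ (+ p) d₁ d₂) second
  where
  identity₁ : ∀ P d₁ d₂ →
    (d₁ - 1ℤ) + P * (d₂ + P * P) ≡ P * (P * P * d₁ + d₂) + (P * P * P - 1ℤ) * (1ℤ - d₁)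
  identity₁ = solve-∀
  identity₂ : ∀ P d₁ d₂ → P * P * (d₁ - 1ℤ) + (d₂ + P * P) ≡ P * P * d₁ + d₂
  identity₂ = solve-∀

D-stepʸ : ∀ p .{{_ : ℕ.NonZero p}} {d₁ d₂} → (d₁ , d₂) ∈ D p → 1ℤ ℤ.≤ d₂ → (d₁ , d₂) ⊕ stepʸ p ∈ D p
D-stepʸ p {d₁} {d₂} (first , _) 1≤d₂ =
    ≤0-by (identity₁ (+ p) d₁ d₂) first
  , ≤0-by (identity₂ (+ p) d₁ d₂)
          (+-mono-≤ (nonneg*nonpos≤0 (nonNegative⁻¹ (+ p)) (nonneg*nonpos≤0 (nonNegative⁻¹ (+ p)) first))
                    (nonneg*nonpos≤0 (cube-pred-nonneg p) (i≤j⇒i-j≤0 1≤d₂)))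
  where
  identity₁ : ∀ P d₁ d₂ → (d₁ + P) + P * (d₂ - 1ℤ) ≡ d₁ + P * d₂
  identity₁ = solve-∀
  identity₂ : ∀ P d₁ d₂ →
    P * P * (d₁ + P) + (d₂ - 1ℤ) ≡ P * (P * (d₁ + P * d₂)) + (P * P * P - 1ℤ) * (1ℤ - d₂)
  identity₂ = solve-∀

≺-refl : ∀ p w → w ≺[ p ] w
≺-refl p (x , y) = ≤-reflexive (identity₁ (+ p) x y) , ≤-reflexive (identity₂ (+ p) x y)
  where
  identity₁ : ∀ P x y → (x - x) + P * (y - y) ≡ 0ℤ
  identity₁ = solve-∀
  identity₂ : ∀ P x y → P * P * (x - x) + (y - y) ≡ 0ℤ
  identity₂ = solve-∀

≺-stepˣ : ∀ p .{{_ : ℕ.NonZero p}} w → w ≺[ p ] (w ⊕ stepˣ p)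
≺-stepˣ p (x , y) =
    ≤0-by (identity₁ (+ p) x y) (nonneg*nonpos≤0 (cube-pred-nonneg p) (neg-≤-pos {1}))
  , ≤-reflexive (identity₂ (+ p) x y)
  where
  identity₁ : ∀ P x y → (x - (x - 1ℤ)) + P * (y - (y + P * P)) ≡ (P * P * P - 1ℤ) * - 1ℤ
  identity₁ = solve-∀
  identity₂ : ∀ P x y → P * P * (x - (x - 1ℤ)) + (y - (y + P * P)) ≡ 0ℤ
  identity₂ = solve-∀

≺-stepʸ : ∀ p .{{_ : ℕ.NonZero p}} w → w ≺[ p ] (w ⊕ stepʸ p)
≺-stepʸ p (x , y) =
    ≤-reflexive (identity₁ (+ p) x y)
  , ≤0-by (identity₂ (+ p) x y) (nonneg*nonpos≤0 (cube-pred-nonneg p) (neg-≤-pos {1}))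
  where
  identity₁ : ∀ P x y → (x - (x + P)) + P * (y - (y - 1ℤ)) ≡ 0ℤ
  identity₁ = solve-∀
  identity₂ : ∀ P x y → P * P * (x - (x + P)) + (y - (y - 1ℤ)) ≡ (P * P * P - 1ℤ) * - 1ℤ
  identity₂ = solve-∀

JDb-translate : ∀ p {J} b {u d} e → u ∈ J → d ⊕ e ∈ D p → ((u ⊕ d) ⊕ (0ℤ , - + b)) ⊕ e ∈ JDb p J b
JDb-translate p b {u} {d} e u∈J d⊕e∈D = u , d ⊕ e , u∈J , d⊕e∈D , ⊕-shift u d (0ℤ , - + b) e

right-edge-stepˣ : ∀ p .{{_ : ℕ.NonZero p}} i b {u d} → 1 ≤ i →
  u ∈ Box 0ℤ (+ i - + 1) → d ∈ D p →
  let w = (u ⊕ d) ⊕ (0ℤ , - + b) in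
  w ∈ Box 0ℤ (+ i) → + i ℤ.≤ proj₁ w →
  d ⊕ stepˣ p ∈ D p × w ⊕ stepˣ p ∈ Box 0ℤ (+ i - + 1)
right-edge-stepˣ p i b {a , c} {d₁ , d₂} 1≤i ((_ , a≤i-1) , (_ , c≤i-1)) d∈D ((_ , x≤i) , (0≤y , _)) i≤x =
  d′∈D , (+-monoˡ-≤ (- 1ℤ) (≤-trans (+≤+ 1≤i) i≤x) , +-monoˡ-≤ (- 1ℤ) x≤i) , (y′-lower , y′-upper)
  where
  identity : ∀ a d₁ I → 1ℤ - d₁ ≡ (a - (I - 1ℤ)) + (I - ((a + d₁) + 0ℤ))
  identity = solve-∀
  1≤d₁ : 1ℤ ℤ.≤ d₁
  1≤d₁ = i-j≤0⇒i≤j (≤0-by (identity a d₁ (+ i)) (+-mono-≤ (i≤j⇒i-j≤0 a≤i-1) (i≤j⇒i-j≤0 i≤x)))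
  d′∈D : (d₁ , d₂) ⊕ stepˣ p ∈ D p
  d′∈D = D-stepˣ p d∈D 1≤d₁
  y′-lower : 0ℤ ℤ.≤ ((c + d₂) + - + b) + + p * + p
  y′-lower = +-nonneg-≥ 0≤y (subst (0ℤ ℤ.≤_) (pos-* p p) (nonNegative⁻¹ _))
  y′-upper : ((c + d₂) + - + b) + + p * + p ℤ.≤ + i - + 1
  y′-upper = subst (ℤ._≤ _) (sym (cong proj₂ (⊕-shift (a , c) (d₁ , d₂) (0ℤ , - + b) (stepˣ p))))
    (+-nonpos-≤ (+-nonpos-≤ c≤i-1 (D-fst-nonneg⇒snd-nonpos p d′∈D (i≤j⇒0≤j-i 1≤d₁))) neg-≤-pos)

top-edge-stepʸ : ∀ p .{{_ : ℕ.NonZero p}} i b {u d} → 1 ≤ i →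
  u ∈ Box 0ℤ (+ i - + 1) → d ∈ D p →
  let w = (u ⊕ d) ⊕ (0ℤ , - + b) in
  w ∈ Box 0ℤ (+ i) → + i ℤ.≤ proj₂ w →
  d ⊕ stepʸ p ∈ D p × w ⊕ stepʸ p ∈ Box 0ℤ (+ i - + 1)
top-edge-stepʸ p i b {a , c} {d₁ , d₂} 1≤i ((_ , a≤i-1) , (_ , c≤i-1)) d∈D ((0≤x , _) , (_ , y≤i)) i≤y =
  d′∈D , (+-nonneg-≥ 0≤x (nonNegative⁻¹ (+ p)) , x′-upper)
       , (+-monoˡ-≤ (- 1ℤ) (≤-trans (+≤+ 1≤i) i≤y) , +-monoˡ-≤ (- 1ℤ) y≤i)
  where
  identity : ∀ c d₂ B I → 1ℤ - d₂ ≡ ((c - (I - 1ℤ)) + (I - ((c + d₂) + - B))) + - B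
  identity = solve-∀
  1≤d₂ : 1ℤ ℤ.≤ d₂
  1≤d₂ = i-j≤0⇒i≤j (≤0-by (identity c d₂ (+ b) (+ i))
    (+-mono-≤ (+-mono-≤ (i≤j⇒i-j≤0 c≤i-1) (i≤j⇒i-j≤0 i≤y)) neg-≤-pos))
  d′∈D : (d₁ , d₂) ⊕ stepʸ p ∈ D p
  d′∈D = D-stepʸ p d∈D 1≤d₂
  x′-upper : ((a + d₁) + 0ℤ) + + p ℤ.≤ + i - + 1
  x′-upper = subst (ℤ._≤ _) (sym (cong proj₁ (⊕-shift (a , c) (d₁ , d₂) (0ℤ , - + b) (stepʸ p))))
    (+-nonpos-≤ (+-nonpos-≤ a≤i-1 (D-snd-nonneg⇒fst-nonpos p d′∈D (i≤j⇒0≤j-i 1≤d₂))) ≤-refl)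

JDb∩Box-dominated : ∀ p .{{_ : ℕ.NonZero p}} i b {J} → 1 ≤ i → J ⊆ Box 0ℤ (+ i - + 1) →
  ∀ {w} → w ∈ JDb p J b ∩ Box 0ℤ (+ i) →
  ∃ λ w′ → w′ ∈ JDb p J b ∩ Box 0ℤ (+ i - + 1) × w ≺[ p ] w′
JDb∩Box-dominated p i b 1≤i J⊆box (w∈JDb@(u , d , u∈J , d∈D , refl) , w∈box@((0≤x , _) , (0≤y , _)))
  with ≤pred⊎≥ (proj₁ ((u ⊕ d) ⊕ (0ℤ , - + b))) i | ≤pred⊎≥ (proj₂ ((u ⊕ d) ⊕ (0ℤ , - + b))) i
... | inj₁ x≤i-1 | inj₁ y≤i-1 =
  _ , (w∈JDb , (0≤x , x≤i-1) , (0≤y , y≤i-1)) , ≺-refl p ((u ⊕ d) ⊕ (0ℤ , - + b))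
... | inj₂ i≤x | _ =
  let d′∈D , w′∈box = right-edge-stepˣ p i b 1≤i (J⊆box u∈J) d∈D w∈box i≤x
  in _ , (JDb-translate p b (stepˣ p) u∈J d′∈D , w′∈box) , ≺-stepˣ p ((u ⊕ d) ⊕ (0ℤ , - + b))
... | inj₁ _ | inj₂ i≤y =
  let d′∈D , w′∈box = top-edge-stepʸ p i b 1≤i (J⊆box u∈J) d∈D w∈box i≤y
  in _ , (JDb-translate p b (stepʸ p) u∈J d′∈D , w′∈box) , ≺-stepʸ p ((u ⊕ d) ⊕ (0ℤ , - + b))

lemma5p4 : (p : ℕ) → Prime p → (i : ℕ) → 1 ≤ i →
    (J K : Pred Pt 0ℓ) →
    IsIdeal p (Box (+ 0) (+ i - + 1)) J →
    IsIdeal p (Box (+ 0) (+ i)) K →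
    (b : ℕ) →
    ((JDb p J b ∩ Box (+ 0) (+ i)) ⊆ K)
      ⇔ ((JDb p J b ∩ Box (+ 0) (+ i - + 1)) ⊆ (K ∩ Box (+ 0) (+ i - + 1)))
lemma5p4 p p-prime i 1≤i J K (J⊆box , _) (_ , K-downward-closed) b = mk⇔ restrict extend
  where
  instance
    p≢0 : ℕ.NonZero p
    p≢0 = prime⇒nonZero p-prime
  restrict : (JDb p J b ∩ Box (+ 0) (+ i)) ⊆ K →
             (JDb p J b ∩ Box (+ 0) (+ i - + 1)) ⊆ (K ∩ Box (+ 0) (+ i - + 1))
  restrict big⊆K (w∈JDb , w∈small) =
    big⊆K (w∈JDb , Box-widen (i≤j⇒i-k≤j (+ 1) ≤-refl) w∈small) , w∈small
  extend : (JDb p J b ∩ Box (+ 0) (+ i - + 1)) ⊆ (K ∩ Box (+ 0) (+ i - + 1)) →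
           (JDb p J b ∩ Box (+ 0) (+ i)) ⊆ K
  extend small⊆K w∈big with JDb∩Box-dominated p i b 1≤i J⊆box w∈big
  ... | _ , w′∈small , w≺w′ = K-downward-closed (proj₁ (small⊆K w′∈small)) (proj₂ w∈big) w≺w′
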